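{- For all natural numbers $n > m \geq 0$ and $0 \leq t \leq m+1$, \[ r^t_{n,m} = r^t_{n,m-1} + \sum_{k=1}^{n-m-1} r^t_{n-k,m-1} \binom{r^{t-1}_{m,m-1}}{k} + \binom{r^{t-1}_{m,m-1}}{n-m} \sum_{k=0}^m r^t_{k,k-1}, \] where $r^t_{0,-1} = 1$ and $r^t_{n,-1} = 0$ for all $n \geq 1$ and $t \geq 0$, and where $\binom{a}{b} = 0$ if $a < b$.
   Context: The adjunctive hierarchy of hereditarily finite sets is defined by $A_0 := \{\emptyset\}$ and $A_{n+1} := \{\emptyset\} \cup \{ x \cup \{y\} : x, y \in A_n\}$, with the convention $A_n := \emptyset$ for integers $n<0$. The (von Neumann) rank is $\mathsf{rk}(\emptyset) = 0$ and $\mathsf{rk}(x) = \max\{\mathsf{rk}(y) : y \in x\} + 1$ for $x \neq \emptyset$. For integers $n, m, t$, let $R^t_{n,m} := \{ x \in A_n \setminus A_{n-1} : x \subseteq A_m \text{ and } \mathsf{rk}(x) \leq t\}$ and $r^t_{n,m} := |R^t_{n,m}|$ (so $r^{t}_{n,m} = 0$ when $t < 0$). -}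

module Defs where

open import Data.Bool using (Bool; true; false; if_then_else_; _∧_; not)
open import Data.Nat using (ℕ; zero; suc; _+_; _*_; _∸_; _^_; _⊔_; _/_; _%_; _≡ᵇ_)
open import Data.Integer using (ℤ; +_; -[1+_]) renaming (_≤ᵇ_ to _≤ℤᵇ_)
open import Data.List using (List; []; _∷_; map; concatMap; filterᵇ; deduplicateᵇ; length; upTo; foldr)
open import Data.Bool.ListAction using (any; all)
open import Data.Nat.ListAction using (sum)

-- Hereditarily finite sets via the Ackermann coding:
-- the HF set coded by c ∈ ℕ has as elements exactly the sets coded by
-- those y whose y-th binary digit of c is 1.  This is a bijection
-- ℕ ≅ HF, so equality of HF sets is equality of codes.

bit : ℕ → ℕ → Bool
bit zero    c = c % 2 ≡ᵇ 1
bit (suc y) c = bit y (c / 2)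

_∈ₕ_ : ℕ → ℕ → Bool
y ∈ₕ c = bit y c

∅ₕ : ℕ
∅ₕ = 0

-- the list of elements of c (every element y of c satisfies y < c,
-- since 2^y ≤ c)
members : ℕ → List ℕ
members c = filterᵇ (λ y → y ∈ₕ c) (upTo c)

adjoin : ℕ → ℕ → ℕ
adjoin x y = if y ∈ₕ x then x else x + 2 ^ y

-- von Neumann rank: rk ∅ = 0, rk x = max {rk y | y ∈ x} + 1.
-- Defined by recursion on a fuel parameter; fuel (suc c) suffices for c
-- because all elements of c are < c.
rankF : ℕ → ℕ → ℕ
rankF zero    c = 0
rankF (suc f) c = foldr (λ y acc → suc (rankF f y) ⊔ acc) 0 (members c)

rk : ℕ → ℕ
rk c = rankF (suc c) c

-- Adjunctive hierarchy (as lists of codes, possibly with repetitions)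
-- A₀ = {∅},  A_{n+1} = {∅} ∪ { x ∪ {y} | x, y ∈ A_n }

Aℕ : ℕ → List ℕ
Aℕ zero    = ∅ₕ ∷ []
Aℕ (suc n) = ∅ₕ ∷ concatMap (λ x → map (λ y → adjoin x y) (Aℕ n)) (Aℕ n)

A : ℤ → List ℕ
A (+ n)    = Aℕ n
A -[1+ n ] = []

_∈ᴸ_ : ℕ → List ℕ → Bool
x ∈ᴸ xs = any (λ z → z ≡ᵇ x) xs

inR : ℤ → ℤ → ℤ → ℕ → Bool
inR n m t x =
  not (x ∈ᴸ A (n Data.Integer.- + 1))
  ∧ all (λ y → y ∈ᴸ A m) (members x)
  ∧ ((+ rk x) ≤ℤᵇ t)

R : ℤ → ℤ → ℤ → List ℕ
R n m t = deduplicateᵇ _≡ᵇ_ (filterᵇ (inR n m t) (A n))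

r : ℤ → ℤ → ℤ → ℕ
r n m t = length (R n m t)

-- Σ_{k=a}^{b} f k  (empty, i.e. 0, when b < a)
sumFromTo : ℕ → ℕ → (ℕ → ℕ) → ℕ
sumFromTo a b f = sum (map (λ i → f (a + i)) (upTo (suc b ∸ a)))

module Submission where

-- Put V = A_{m-1} and W = A_m \ A_{m-1} (the new elements of level m);
-- every x ⊆ A_m is a disjoint union a ∪ b with a ⊆ V and b ⊆ W.  Two facts
-- govern such unions:
--  * adjoining a new element of level m to a subset of A_m raises the level
--    in the hierarchy by exactly one (insert-top⁺/⁻), so for |b| = k > 0,
--    a ∪ b ∈ A_N iff m + k ≤ N and a ∈ A_{N-k} (level-of-union);
--  * rk (a ∪ b) ≤ t iff rk a ≤ t and every element of b has rank < t.
-- Hence r^t_{n,m} = Σ_k C(c, k) G(k): the b of size k are the k-subsets of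
-- the c = r^{t-1}_{m,m-1} new elements of rank < t (ΣSub-binomial), and G(k)
-- counts the admissible a, namely r^t_{n,m-1} for k = 0, r^t_{n-k,m-1} for
-- 0 < k < n - m, Σ_{j ≤ m} r^t_{j,j-1} for k = n - m, and 0 beyond.

open import Defs
open import Data.Bool using (Bool; true; false; T; _∧_; not)
open import Data.Bool.ListAction using (all)
import Data.Integer as ℤ
open import Data.Nat using (ℕ; zero; suc; _+_; _*_; _∸_; _^_; _⊔_; _/_; _%_; _≡ᵇ_; _≤ᵇ_; _<_; _≤_; z≤n; s≤s; _≟_; _<?_)
open import Data.Nat.Properties
open import Data.Nat.DivMod
open import Algebra.Properties.CommutativeSemigroup +-commutativeSemigroup using () renaming (interchange to +-interchange)
open import Data.Nat.Divisibility using (n∣m*n)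
open import Data.Nat.Induction using (<-rec)
open import Data.Product using (∃; ∃₂; _×_; _,_; proj₁; proj₂)
open import Data.Sum using (_⊎_; inj₁; inj₂) renaming ([_,_] to ⊎-elim)
open import Data.Empty using (⊥; ⊥-elim)
open import Relation.Nullary using (¬_; yes; no)
open import Function using (_∘_)
open import Relation.Binary.PropositionalEquality
open import Function.Bundles using (mk⇔; Equivalence; _⇔_)
open import Data.Bool.Properties using (T-≡; ∧-identityʳ; ∧-zeroʳ; ⇔→≡)
open import Data.Nat.Combinatorics using (_C_; k>n⇒nCk≡0; nCk+nC[k+1]≡[n+1]C[k+1])
open import Data.List using (List; []; _∷_; _++_; foldr; upTo; applyUpTo; concatMap; cartesianProductWith; length; filter; filterᵇ; deduplicate; deduplicateᵇ; map)
open import Data.List.Properties using (filter-≐; filter-++; length-++; map-applyUpTo; length-filter)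
open import Data.Nat.ListAction using (sum)
open import Data.List.Membership.Propositional using (_∈_; _∉_)
open import Data.List.Membership.Propositional.Properties
  using (∈-filter⁺; ∈-filter⁻; ∈-upTo⁺; ∈-++⁻; ∈-++⁺ˡ; ∈-++⁺ʳ; ∈-map⁺; ∈-map⁻; ∈-cartesianProductWith⁺; ∈-cartesianProductWith⁻; ∈-deduplicate⁺; ∈-deduplicate⁻)
open import Data.List.Membership.Propositional.Properties.WithK using (unique∧set⇒bag)
open import Data.List.Relation.Binary.BagAndSetEquality using (∼bag⇒↭)
open import Data.List.Relation.Binary.Permutation.Propositional.Properties using (↭-length)
open import Data.List.Relation.Unary.Any using (here; there)
open import Data.List.Relation.Unary.All using (All; []; lookup; tabulate)
open import Data.List.Relation.Unary.All.Properties using (All¬⇒¬Any; all⁺; all⁻)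
open import Data.List.Relation.Unary.Unique.Propositional using (Unique; []; _∷_)
import Data.List.Relation.Unary.Unique.Propositional.Properties as Unique
open import Data.List.Relation.Unary.Unique.DecPropositional.Properties _≟_ using (deduplicate-!)
open import Relation.Nullary.Decidable using (T?)

true-and-false : ∀ {b : Bool} → b ≡ true → b ≡ false → ⊥
true-and-false refl ()

∧-true⁻ : ∀ {a b} → (a ∧ b) ≡ true → a ≡ true × b ≡ true
∧-true⁻ {true} {true} _ = refl , refl

∧-true⁺ : ∀ {a b} → a ≡ true → b ≡ true → (a ∧ b) ≡ true
∧-true⁺ refl refl = refl

not-true⁻ : ∀ {a} → not a ≡ true → a ≡ false
not-true⁻ {false} _ = refl

not-true⁺ : ∀ {a} → a ≡ false → not a ≡ true
not-true⁺ refl = refl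

Bool-ext : ∀ {a b} → (a ≡ true → b ≡ true) → (b ≡ true → a ≡ true) → a ≡ b
Bool-ext a⇒b b⇒a = ⇔→≡ (mk⇔ a⇒b b⇒a)

all-true⁻ : ∀ (p : ℕ → Bool) xs → all p xs ≡ true → ∀ {y} → y ∈ xs → p y ≡ true
all-true⁻ p xs e y∈ = Equivalence.to T-≡ (lookup (all⁺ p xs (Equivalence.from T-≡ e)) y∈)

all-true⁺ : ∀ (p : ℕ → Bool) xs → (∀ {y} → y ∈ xs → p y ≡ true) → all p xs ≡ true
all-true⁺ p xs ps = Equivalence.to T-≡ (all⁻ p (tabulate (Equivalence.from T-≡ ∘ ps)))

≤ᵇ-true⁺ : ∀ {a b} → a ≤ b → (a ≤ᵇ b) ≡ true
≤ᵇ-true⁺ a≤b = Equivalence.to T-≡ (≤⇒≤ᵇ a≤b)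

≤ᵇ-true⁻ : ∀ {a b} → (a ≤ᵇ b) ≡ true → a ≤ b
≤ᵇ-true⁻ {a} {b} e = ≤ᵇ⇒≤ a b (Equivalence.from T-≡ e)

≤ᵇ-false : ∀ {a b} → ¬ a ≤ b → (a ≤ᵇ b) ≡ false
≤ᵇ-false {a} {b} a≰b with a ≤ᵇ b in e
... | false = refl
... | true  = ⊥-elim (a≰b (≤ᵇ-true⁻ e))

∈ᴸ⇒∈ : ∀ {x} xs → (x ∈ᴸ xs) ≡ true → x ∈ xs
∈ᴸ⇒∈ {x} (y ∷ xs) e with y ≡ᵇ x in y≡x
... | true  = here (sym (≡ᵇ⇒≡ y x (Equivalence.from T-≡ y≡x)))
... | false = there (∈ᴸ⇒∈ xs e)

∈⇒∈ᴸ : ∀ {x xs} → x ∈ xs → (x ∈ᴸ xs) ≡ true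
∈⇒∈ᴸ {x} {y ∷ xs} (here refl) with x ≡ᵇ x in x≡x
... | true  = refl
... | false = ⊥-elim (subst T x≡x (≡⇒≡ᵇ x x refl))
∈⇒∈ᴸ {x} {y ∷ xs} (there x∈) with y ≡ᵇ x
... | true  = refl
... | false = ∈⇒∈ᴸ x∈

∉⇒∉ᴸ : ∀ {x} xs → x ∉ xs → (x ∈ᴸ xs) ≡ false
∉⇒∉ᴸ {x} xs x∉ with x ∈ᴸ xs in e
... | true  = ⊥-elim (x∉ (∈ᴸ⇒∈ xs e))
... | false = refl

∈-filterᵇ⁺ : ∀ (p : ℕ → Bool) {x xs} → x ∈ xs → p x ≡ true → x ∈ filterᵇ p xs
∈-filterᵇ⁺ p x∈ px = ∈-filter⁺ (T? ∘ p) x∈ (Equivalence.from T-≡ px)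

∈-filterᵇ⁻ : ∀ (p : ℕ → Bool) {x} xs → x ∈ filterᵇ p xs → x ∈ xs × p x ≡ true
∈-filterᵇ⁻ p xs x∈ with ∈-filter⁻ (T? ∘ p) {xs = xs} x∈
... | x∈xs , px = x∈xs , Equivalence.to T-≡ px

dedup : List ℕ → List ℕ
dedup = deduplicateᵇ _≡ᵇ_

dedup≡deduplicate : ∀ xs → dedup xs ≡ deduplicate _≟_ xs
dedup≡deduplicate []       = refl
dedup≡deduplicate (x ∷ xs) = cong (x ∷_)
  (trans (filter-≐ _ _ (≢ᵇ⇒≢ , ≢⇒≢ᵇ) (dedup xs)) (cong (filter _) (dedup≡deduplicate xs)))
  where
  ≢ᵇ⇒≢ : ∀ {y} → ¬ T (x ≡ᵇ y) → ¬ x ≡ y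
  ≢ᵇ⇒≢ {y} x≢y x≡y = x≢y (≡⇒≡ᵇ x y x≡y)
  ≢⇒≢ᵇ : ∀ {y} → ¬ x ≡ y → ¬ T (x ≡ᵇ y)
  ≢⇒≢ᵇ {y} x≢y x≡y = x≢y (≡ᵇ⇒≡ x y x≡y)

dedup-unique : ∀ xs → Unique (dedup xs)
dedup-unique xs = subst Unique (sym (dedup≡deduplicate xs)) (deduplicate-! xs)

∈-dedup⁺ : ∀ {x} xs → x ∈ xs → x ∈ dedup xs
∈-dedup⁺ xs x∈ = subst (_ ∈_) (sym (dedup≡deduplicate xs)) (∈-deduplicate⁺ _≟_ x∈)

∈-dedup⁻ : ∀ {x} xs → x ∈ dedup xs → x ∈ xs
∈-dedup⁻ xs x∈ = ∈-deduplicate⁻ _ xs x∈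

same-elements⇒same-length : ∀ {xs ys : List ℕ} → Unique xs → Unique ys →
  (∀ {x} → x ∈ xs → x ∈ ys) → (∀ {x} → x ∈ ys → x ∈ xs) → length xs ≡ length ys
same-elements⇒same-length u v xs⊆ys ys⊆xs =
  ↭-length (∼bag⇒↭ (unique∧set⇒bag u v (mk⇔ xs⊆ys ys⊆xs)))

_∈ₛ_ _∉ₛ_ : ℕ → ℕ → Set
y ∈ₛ x = bit y x ≡ true
y ∉ₛ x = bit y x ≡ false

bit0-+even : ∀ x k → bit 0 (x + k * 2) ≡ bit 0 x
bit0-+even x k = cong (_≡ᵇ 1) ([m+kn]%n≡m%n x k 2)

bitS-+even : ∀ y x k → bit (suc y) (x + k * 2) ≡ bit y (x / 2 + k)
bitS-+even y x k = cong (bit y) (begin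
  (x + k * 2) / 2     ≡⟨ +-distrib-/-∣ʳ x (n∣m*n k) ⟩
  x / 2 + k * 2 / 2   ≡⟨ cong (x / 2 +_) (m*n/n≡m k 2) ⟩
  x / 2 + k           ∎)
  where open ≡-Reasoning

∉ₛ-empty : ∀ y → y ∉ₛ 0
∉ₛ-empty zero    = refl
∉ₛ-empty (suc y) = ∉ₛ-empty y

∅-has-no-element : ∀ y → ¬ y ∈ₛ 0
∅-has-no-element y y∈ = true-and-false y∈ (∉ₛ-empty y)

lowest-digit-0 : ∀ x → 0 ∉ₛ x → x ≡ x / 2 * 2
lowest-digit-0 x x0 = trans (m≡m%n+[m/n]*n x 2) (cong (_+ x / 2 * 2) (digit (x % 2) (m%n<n x 2) x0))
  where
  digit : ∀ b → b < 2 → (b ≡ᵇ 1) ≡ false → b ≡ 0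
  digit zero          _                 _  = refl
  digit (suc zero)    _                 ()
  digit (suc (suc _)) (s≤s (s≤s ()))    _

lowest-digit-1 : ∀ x → 0 ∈ₛ x → x ≡ 1 + x / 2 * 2
lowest-digit-1 x x0 = trans (m≡m%n+[m/n]*n x 2) (cong (_+ x / 2 * 2) (digit (x % 2) (m%n<n x 2) x0))
  where
  digit : ∀ b → b < 2 → (b ≡ᵇ 1) ≡ true → b ≡ 1
  digit zero          _                 ()
  digit (suc zero)    _                 _  = refl
  digit (suc (suc _)) (s≤s (s≤s ()))    _

2^suc : ∀ y → 2 ^ suc y ≡ 2 ^ y * 2
2^suc y = *-comm 2 (2 ^ y)

insert-new : ∀ y x → y ∉ₛ x → y ∈ₛ (x + 2 ^ y)
insert-new zero x x0 =
  trans (cong (bit 0) (trans (+-comm x 1) (cong suc (lowest-digit-0 x x0)))) (bit0-+even 1 (x / 2))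
insert-new (suc y) x yx =
  trans (cong (bit (suc y)) (cong (x +_) (2^suc y)))
        (trans (bitS-+even y x (2 ^ y)) (insert-new y (x / 2) yx))

insert-other : ∀ y x z → y ∉ₛ x → z ≢ y → bit z (x + 2 ^ y) ≡ bit z x
insert-other zero    x zero    x0 z≢y = ⊥-elim (z≢y refl)
insert-other zero    x (suc z) x0 _   =
  trans (cong (bit (suc z)) (trans (+-comm x 1) (cong suc (lowest-digit-0 x x0))))
        (bitS-+even z 1 (x / 2))
insert-other (suc y) x zero    _  _   =
  trans (cong (bit 0) (cong (x +_) (2^suc y))) (bit0-+even x (2 ^ y))
insert-other (suc y) x (suc z) yx z≢y =
  trans (cong (bit (suc z)) (cong (x +_) (2^suc y)))
        (trans (bitS-+even z x (2 ^ y)) (insert-other y (x / 2) z yx (λ z≡y → z≢y (cong suc z≡y))))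

insert-cases : ∀ y x z → y ∉ₛ x → z ∈ₛ (x + 2 ^ y) → z ∈ₛ x ⊎ z ≡ y
insert-cases y x z yx zx with z ≟ y
... | yes z≡y = inj₂ z≡y
... | no  z≢y = inj₁ (trans (sym (insert-other y x z yx z≢y)) zx)

insert-keeps : ∀ y x z → y ∉ₛ x → z ∈ₛ x → z ∈ₛ (x + 2 ^ y)
insert-keeps y x z yx zx with z ≟ y
... | yes refl = insert-new y x yx
... | no  z≢y  = trans (insert-other y x z yx z≢y) zx

remove : ∀ y x → y ∈ₛ x → ∃ λ x' → y ∉ₛ x' × x ≡ x' + 2 ^ y
remove zero x x0 = x / 2 * 2 , bit0-+even 0 (x / 2) , trans (lowest-digit-1 x x0) (+-comm 1 _)
remove (suc y) x yx with remove y (x / 2) yx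
... | h , yh , x/2≡h+2^y = x % 2 + h * 2 , y∉ , x≡
  where
  open ≡-Reasoning
  y∉ : suc y ∉ₛ (x % 2 + h * 2)
  y∉ = trans (bitS-+even y (x % 2) h)
             (trans (cong (λ q → bit y (q + h)) (m<n⇒m/n≡0 (m%n<n x 2))) yh)
  x≡ : x ≡ x % 2 + h * 2 + 2 ^ suc y
  x≡ = begin
    x                              ≡⟨ m≡m%n+[m/n]*n x 2 ⟩
    x % 2 + x / 2 * 2              ≡⟨ cong (λ q → x % 2 + q * 2) x/2≡h+2^y ⟩
    x % 2 + (h + 2 ^ y) * 2        ≡⟨ cong (x % 2 +_) (*-distribʳ-+ 2 h (2 ^ y)) ⟩
    x % 2 + (h * 2 + 2 ^ y * 2)    ≡⟨ sym (+-assoc (x % 2) (h * 2) (2 ^ y * 2)) ⟩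
    x % 2 + h * 2 + 2 ^ y * 2      ≡⟨ cong (x % 2 + h * 2 +_) (sym (2^suc y)) ⟩
    x % 2 + h * 2 + 2 ^ suc y      ∎

-- Every element is coded by a smaller number (so recursion on members
-- terminates).
n<2^n : ∀ n → n < 2 ^ n
n<2^n zero    = s≤s z≤n
n<2^n (suc n) = subst (_≤ 2 ^ suc n) (+-comm (suc n) 1)
  (subst (suc n + 1 ≤_) (cong (2 ^ n +_) (sym (+-identityʳ (2 ^ n))))
         (+-mono-≤ (n<2^n n) (m^n>0 2 n)))

member< : ∀ y x → y ∈ₛ x → y < x
member< y x yx with remove y x yx
... | x' , _ , refl = ≤-trans (n<2^n y) (m≤n+m (2 ^ y) x')

no-elements⇒0 : ∀ x → (∀ y → y ∉ₛ x) → x ≡ 0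
no-elements⇒0 = <-rec _ by-halving
  where
  by-halving : ∀ x → (∀ {h} → h < x → (∀ y → y ∉ₛ h) → h ≡ 0) → (∀ y → y ∉ₛ x) → x ≡ 0
  by-halving zero    _   _    = refl
  by-halving (suc x) rec none = ⊥-elim (1+n≢0 (trans (lowest-digit-0 (suc x) (none 0)) (cong (_* 2) half≡0)))
    where
    half≡0 : suc x / 2 ≡ 0
    half≡0 = rec (m/n<m (suc x) 2 (s≤s (s≤s z≤n))) (λ y → none (suc y))

_⊆ₛ_ : ℕ → List ℕ → Set
x ⊆ₛ U = ∀ z → z ∈ₛ x → z ∈ U

⊆ₛ-fresh : ∀ {x L} u → x ⊆ₛ L → u ∉ L → u ∉ₛ x
⊆ₛ-fresh {x} u x⊆L u∉L with bit u x in u∈?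
... | false = refl
... | true  = ⊥-elim (u∉L (x⊆L u u∈?))

∈-members⁺ : ∀ {y} x → y ∈ₛ x → y ∈ members x
∈-members⁺ {y} x yx = ∈-filterᵇ⁺ (_∈ₕ x) (∈-upTo⁺ (member< y x yx)) yx

∈-members⁻ : ∀ {y} x → y ∈ members x → y ∈ₛ x
∈-members⁻ {y} x y∈ = proj₂ (∈-filterᵇ⁻ (_∈ₕ x) (upTo x) y∈)

maxOver : (ℕ → ℕ) → List ℕ → ℕ
maxOver g = foldr (λ y acc → g y ⊔ acc) 0

maxOver≤⇒ : ∀ g ys {s} → maxOver g ys ≤ s → ∀ {y} → y ∈ ys → g y ≤ s
maxOver≤⇒ g (y ∷ ys) le (here refl) = ≤-trans (m≤m⊔n (g y) _) le
maxOver≤⇒ g (y ∷ ys) le (there y∈) = maxOver≤⇒ g ys (≤-trans (m≤n⊔m (g y) _) le) y∈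

⇒maxOver≤ : ∀ g ys {s} → (∀ {y} → y ∈ ys → g y ≤ s) → maxOver g ys ≤ s
⇒maxOver≤ g []       _     = z≤n
⇒maxOver≤ g (y ∷ ys) bound = ⊔-lub (bound (here refl)) (⇒maxOver≤ g ys (bound ∘ there))

maxOver-cong : ∀ g h ys → (∀ {y} → y ∈ ys → g y ≡ h y) → maxOver g ys ≡ maxOver h ys
maxOver-cong g h []       _  = refl
maxOver-cong g h (y ∷ ys) eq = cong₂ _⊔_ (eq (here refl)) (maxOver-cong g h ys (eq ∘ there))

rankF-fuel : ∀ f g x → x < f → x < g → rankF f x ≡ rankF g x
rankF-fuel (suc f) (suc g) x (s≤s x≤f) (s≤s x≤g) = maxOver-cong _ _ (members x) λ {y} y∈ →
  let y<x = member< y x (∈-members⁻ x y∈) in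
  cong suc (rankF-fuel f g y (≤-trans y<x x≤f) (≤-trans y<x x≤g))

rk-unfold : ∀ x → rk x ≡ maxOver (λ y → suc (rk y)) (members x)
rk-unfold x = maxOver-cong _ _ (members x) λ {y} y∈ →
  cong suc (rankF-fuel x (suc y) y (member< y x (∈-members⁻ x y∈)) ≤-refl)

rk≤⇒ : ∀ x {s} → rk x ≤ s → ∀ y → y ∈ₛ x → suc (rk y) ≤ s
rk≤⇒ x {s} le y yx =
  maxOver≤⇒ (λ y → suc (rk y)) (members x) (subst (_≤ s) (rk-unfold x) le) (∈-members⁺ {y} x yx)

⇒rk≤ : ∀ x {s} → (∀ y → y ∈ₛ x → suc (rk y) ≤ s) → rk x ≤ s
⇒rk≤ x {s} bound =
  subst (_≤ s) (sym (rk-unfold x)) (⇒maxOver≤ _ (members x) λ {y} y∈ → bound y (∈-members⁻ x y∈))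

rk-union≤ : ∀ a b c {s} → (∀ z → z ∈ₛ c ⇔ (z ∈ₛ a ⊎ z ∈ₛ b)) → rk c ≤ s ⇔ (rk a ≤ s × rk b ≤ s)
rk-union≤ a b c {s} elements = mk⇔
  (λ c≤ → ⇒rk≤ a (λ y y∈ → rk≤⇒ c c≤ y (Equivalence.from (elements y) (inj₁ y∈)))
        , ⇒rk≤ b (λ y y∈ → rk≤⇒ c c≤ y (Equivalence.from (elements y) (inj₂ y∈))))
  (λ (a≤ , b≤) → ⇒rk≤ c (λ y y∈ → ⊎-elim (rk≤⇒ a a≤ y) (rk≤⇒ b b≤ y) (Equivalence.to (elements y) y∈)))

rk-insert≤ : ∀ u x {s} → u ∉ₛ x → rk (x + 2 ^ u) ≤ s ⇔ (rk x ≤ s × suc (rk u) ≤ s)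
rk-insert≤ u x {s} u∉x = mk⇔
  (λ x+u≤ → ⇒rk≤ x (λ y y∈ → rk≤⇒ (x + 2 ^ u) x+u≤ y (insert-keeps u x y u∉x y∈))
          , rk≤⇒ (x + 2 ^ u) x+u≤ u (insert-new u x u∉x))
  (λ (x≤ , u<) → ⇒rk≤ (x + 2 ^ u) λ y y∈ → ⊎-elim (rk≤⇒ x x≤ y) (λ { refl → u< }) (insert-cases u x y u∉x y∈))

Aℕ-suc : ∀ n → Aℕ (suc n) ≡ ∅ₕ ∷ cartesianProductWith adjoin (Aℕ n) (Aℕ n)
Aℕ-suc n = cong (∅ₕ ∷_) (concatMap≡ (Aℕ n))
  where
  concatMap≡ : ∀ xs → concatMap (λ a → map (adjoin a) (Aℕ n)) xs ≡ cartesianProductWith adjoin xs (Aℕ n)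
  concatMap≡ []       = refl
  concatMap≡ (a ∷ xs) = cong (map (adjoin a) (Aℕ n) ++_) (concatMap≡ xs)

∈A-suc⁻ : ∀ n {x} → x ∈ Aℕ (suc n) → x ≡ 0 ⊎ ∃₂ λ a b → a ∈ Aℕ n × b ∈ Aℕ n × x ≡ adjoin a b
∈A-suc⁻ n {x} x∈ with subst (x ∈_) (Aℕ-suc n) x∈
... | here x≡0   = inj₁ x≡0
... | there x∈AA = inj₂ (∈-cartesianProductWith⁻ adjoin (Aℕ n) (Aℕ n) x∈AA)

adjoin∈A : ∀ n {a b} → a ∈ Aℕ n → b ∈ Aℕ n → adjoin a b ∈ Aℕ (suc n)
adjoin∈A n {a} {b} a∈ b∈ = subst (adjoin a b ∈_) (sym (Aℕ-suc n)) (there (∈-cartesianProductWith⁺ adjoin a∈ b∈))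

∈A-zero⁻ : ∀ {x} → x ∈ Aℕ 0 → x ≡ 0
∈A-zero⁻ (here x≡0) = x≡0

adjoin-new : ∀ a b → b ∉ₛ a → adjoin a b ≡ a + 2 ^ b
adjoin-new a b b∉a rewrite b∉a = refl

adjoin-cases : ∀ a b z → z ∈ₛ adjoin a b → z ∈ₛ a ⊎ z ≡ b
adjoin-cases a b z z∈ with bit b a in b∈?a
... | true  = inj₁ z∈
... | false = insert-cases b a z b∈?a z∈

A-mono : ∀ n {x} → x ∈ Aℕ n → x ∈ Aℕ (suc n)
A-mono zero    x∈ rewrite ∈A-zero⁻ x∈ = here refl
A-mono (suc n) x∈ with ∈A-suc⁻ n x∈
... | inj₁ refl                     = here refl
... | inj₂ (a , b , a∈ , b∈ , refl) = adjoin∈A (suc n) (A-mono n a∈) (A-mono n b∈)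

A-mono≤ : ∀ {i j x} → i ≤ j → x ∈ Aℕ i → x ∈ Aℕ j
A-mono≤ {i} {j} {x} i≤j x∈ with m≤n⇒∃[o]m+o≡n i≤j
... | k , refl = raise k
  where
  raise : ∀ k → x ∈ Aℕ (i + k)
  raise zero    rewrite +-identityʳ i = x∈
  raise (suc k) rewrite +-suc i k     = A-mono (i + k) (raise k)

A-elements : ∀ n {x y} → x ∈ Aℕ (suc n) → y ∈ₛ x → y ∈ Aℕ n
A-elements n {y = y} x∈ y∈x with ∈A-suc⁻ n x∈
... | inj₁ refl = ⊥-elim (∅-has-no-element y y∈x)
... | inj₂ (a , b , a∈ , b∈ , refl) with adjoin-cases a b y y∈x
...   | inj₂ refl = b∈
...   | inj₁ y∈a with n
...     | zero   rewrite ∈A-zero⁻ a∈ = ⊥-elim (∅-has-no-element y y∈a)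
...     | suc n' = A-mono n' (A-elements n' a∈ y∈a)

MaximalIn : ℕ → ℕ → Set
MaximalIn y z = ∀ i → y ∈ Aℕ i → ∀ u → u ∈ₛ z → u ∈ Aℕ i

remove-maximal : ∀ n z y → y ∈ₛ z → MaximalIn y z → z ∈ Aℕ (suc n) → z ∸ 2 ^ y ∈ Aℕ n
remove-maximal n z y y∈z maximal z∈ with ∈A-suc⁻ n z∈
... | inj₁ refl = ⊥-elim (∅-has-no-element y y∈z)
... | inj₂ (a , b , a∈ , b∈ , refl) with bit b a in b∈?a
...   | true with n
...     | zero   rewrite ∈A-zero⁻ a∈ = ⊥-elim (∅-has-no-element y y∈z)
...     | suc n' = A-mono n' (remove-maximal n' a y y∈z maximal a∈)
remove-maximal n z y y∈z maximal z∈ | inj₂ (a , b , a∈ , b∈ , refl) | false with y ≟ b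
...   | yes refl = subst (_∈ Aℕ n) (sym (m+n∸n≡m a (2 ^ y))) a∈
...   | no  y≢b with insert-cases b a y b∈?a y∈z
...     | inj₂ y≡b = ⊥-elim (y≢b y≡b)
...     | inj₁ y∈a with n
...       | zero   rewrite ∈A-zero⁻ a∈ = ⊥-elim (∅-has-no-element y y∈a)
...       | suc n' with remove y a y∈a
...         | a' , y∉a' , refl =
  subst (_∈ Aℕ (suc n')) (sym reorder) (subst (_∈ Aℕ (suc n')) (adjoin-new a' b b∉a') (adjoin∈A n' a'∈ b∈'))
  where
  maximal-a : MaximalIn y (a' + 2 ^ y)
  maximal-a i y∈A u u∈a = maximal i y∈A u (insert-keeps b (a' + 2 ^ y) u b∈?a u∈a)
  a'∈ : a' ∈ Aℕ n'
  a'∈ = subst (_∈ Aℕ n') (m+n∸n≡m a' (2 ^ y)) (remove-maximal n' (a' + 2 ^ y) y y∈a maximal-a a∈)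
  b∈' : b ∈ Aℕ n'
  b∈' = maximal n' (A-elements n' a∈ y∈a) b (insert-new b (a' + 2 ^ y) b∈?a)
  b∉a' : b ∉ₛ a'
  b∉a' with bit b a' in b∈?a'
  ... | false = refl
  ... | true  = ⊥-elim (true-and-false (insert-keeps y a' b y∉a' b∈?a') b∈?a)
  reorder : a' + 2 ^ y + 2 ^ b ∸ 2 ^ y ≡ a' + 2 ^ b
  reorder = begin
    a' + 2 ^ y + 2 ^ b ∸ 2 ^ y   ≡⟨ cong (_∸ 2 ^ y) (+-assoc a' (2 ^ y) (2 ^ b)) ⟩
    a' + (2 ^ y + 2 ^ b) ∸ 2 ^ y ≡⟨ cong (λ q → a' + q ∸ 2 ^ y) (+-comm (2 ^ y) (2 ^ b)) ⟩
    a' + (2 ^ b + 2 ^ y) ∸ 2 ^ y ≡⟨ cong (_∸ 2 ^ y) (sym (+-assoc a' (2 ^ b) (2 ^ y))) ⟩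
    a' + 2 ^ b + 2 ^ y ∸ 2 ^ y   ≡⟨ m+n∸n≡m (a' + 2 ^ b) (2 ^ y) ⟩
    a' + 2 ^ b                   ∎
    where open ≡-Reasoning

Aprev : ℕ → List ℕ
Aprev zero    = []
Aprev (suc m) = Aℕ m

Aprev⊆A : ∀ m {x} → x ∈ Aprev m → x ∈ Aℕ m
Aprev⊆A (suc m) x∈ = A-mono m x∈

Aprev-mono : ∀ {j m} → j ≤ m → ∀ {x} → x ∈ Aprev j → x ∈ Aprev m
Aprev-mono {suc j} {suc m} (s≤s j≤m) x∈ = A-mono≤ j≤m x∈

A-elements-prev : ∀ j {x y} → x ∈ Aℕ j → y ∈ₛ x → y ∈ Aprev j
A-elements-prev zero    {y = y} x∈ y∈x rewrite ∈A-zero⁻ x∈ = ⊥-elim (∅-has-no-element y y∈x)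
A-elements-prev (suc j) x∈ y∈x = A-elements j x∈ y∈x

NewAt : ℕ → ℕ → Set
NewAt m u = u ∈ Aℕ m × u ∉ Aprev m

new-level≤ : ∀ m {u i} → u ∉ Aprev m → u ∈ Aℕ i → m ≤ i
new-level≤ zero    _   _  = z≤n
new-level≤ (suc m) {u} {i} u∉ u∈ with m <? i
... | yes m<i = m<i
... | no  m≮i = ⊥-elim (u∉ (A-mono≤ (≮⇒≥ m≮i) u∈))

insert-top⁺ : ∀ n' u x → u ∉ₛ x → u ∈ Aℕ n' → x ∈ Aℕ n' → x + 2 ^ u ∈ Aℕ (suc n')
insert-top⁺ n' u x u∉x u∈ x∈ = subst (_∈ Aℕ (suc n')) (adjoin-new x u u∉x) (adjoin∈A n' x∈ u∈)

insert-top⁻ : ∀ m n u x → u ∉ₛ x → NewAt m u → (∀ v → v ∈ₛ (x + 2 ^ u) → v ∈ Aℕ m) →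
  x + 2 ^ u ∈ Aℕ n → ∃ λ n' → n ≡ suc n' × m ≤ n' × x ∈ Aℕ n'
insert-top⁻ m zero u x u∉x _ _ x+u∈ =
  ⊥-elim (∅-has-no-element u (subst (u ∈ₛ_) (∈A-zero⁻ x+u∈) (insert-new u x u∉x)))
insert-top⁻ m (suc n') u x u∉x (u∈Am , u∉prev) ⊆Am x+u∈ =
  n' , refl , new-level≤ m u∉prev u∈n' , subst (_∈ Aℕ n') (m+n∸n≡m x (2 ^ u)) x∈
  where
  u∈n' : u ∈ Aℕ n'
  u∈n' = A-elements n' x+u∈ (insert-new u x u∉x)
  maximal : MaximalIn u (x + 2 ^ u)
  maximal i u∈i v v∈ = A-mono≤ (new-level≤ m u∉prev u∈i) (⊆Am v v∈)
  x∈ : x + 2 ^ u ∸ 2 ^ u ∈ Aℕ n'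
  x∈ = remove-maximal n' (x + 2 ^ u) u (insert-new u x u∉x) maximal x+u∈

Σ< : ℕ → (ℕ → ℕ) → ℕ
Σ< zero    f = 0
Σ< (suc N) f = f 0 + Σ< N (f ∘ suc)

Σ<-snoc : ∀ N f → Σ< (suc N) f ≡ Σ< N f + f N
Σ<-snoc zero    f = +-comm (f 0) 0
Σ<-snoc (suc N) f = trans (cong (f 0 +_) (Σ<-snoc N (f ∘ suc))) (sym (+-assoc (f 0) _ _))

Σ<-cong : ∀ N f g → (∀ {k} → k < N → f k ≡ g k) → Σ< N f ≡ Σ< N g
Σ<-cong zero    f g eq = refl
Σ<-cong (suc N) f g eq = cong₂ _+_ (eq (s≤s z≤n)) (Σ<-cong N _ _ (eq ∘ s≤s))

Σ<-+ : ∀ N f g → Σ< N (λ k → f k + g k) ≡ Σ< N f + Σ< N g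
Σ<-+ zero    f g = refl
Σ<-+ (suc N) f g = trans (cong ((f 0 + g 0) +_) (Σ<-+ N _ _)) (+-interchange (f 0) (g 0) _ _)

Σ<-first-last : ∀ d f → Σ< (suc (suc d)) f ≡ f 0 + Σ< d (f ∘ suc) + f (suc d)
Σ<-first-last d f =
  trans (cong (f 0 +_) (Σ<-snoc d (f ∘ suc))) (sym (+-assoc (f 0) (Σ< d (f ∘ suc)) (f (suc d))))

Σ<-vanishing : ∀ N e f → (∀ {k} → N ≤ k → f k ≡ 0) → Σ< (N + e) f ≡ Σ< N f
Σ<-vanishing zero    zero    f f≡0 = refl
Σ<-vanishing zero    (suc e) f f≡0 = cong₂ _+_ (f≡0 z≤n) (Σ<-vanishing zero e (f ∘ suc) (λ {k} _ → f≡0 {suc k} z≤n))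
Σ<-vanishing (suc N) e       f f≡0 = cong (f 0 +_) (Σ<-vanishing N e (f ∘ suc) (f≡0 ∘ s≤s))

sum-applyUpTo : ∀ f N → sum (applyUpTo f N) ≡ Σ< N f
sum-applyUpTo f zero    = refl
sum-applyUpTo f (suc N) = cong (f 0 +_) (sum-applyUpTo (f ∘ suc) N)

sumFromTo≡Σ< : ∀ a b f → sumFromTo a b f ≡ Σ< (suc b ∸ a) (λ i → f (a + i))
sumFromTo≡Σ< a b f = trans (cong sum (map-applyUpTo _ _ (suc b ∸ a))) (sum-applyUpTo _ (suc b ∸ a))

𝟙 : Bool → ℕ
𝟙 true  = 1
𝟙 false = 0

count : (ℕ → Bool) → List ℕ → ℕ
count p W = length (filterᵇ p W)

count≤length : ∀ p W → count p W ≤ length W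
count≤length p W = length-filter (T? ∘ p) W

𝟙-∧-split : ∀ {p p'} q → (p ≡ true → p' ≡ true) → 𝟙 (p' ∧ q) ≡ 𝟙 (p ∧ q) + 𝟙 (p' ∧ (not p ∧ q))
𝟙-∧-split {true}  {true}  true  _   = refl
𝟙-∧-split {true}  {true}  false _   = refl
𝟙-∧-split {true}  {false} q     p⇒p' with p⇒p' refl
... | ()
𝟙-∧-split {false} {true}  true  _   = refl
𝟙-∧-split {false} {true}  false _   = refl
𝟙-∧-split {false} {false} q     _   = refl

𝟙-split : ∀ p q r s → 𝟙 (p ∧ (not q ∧ (r ∧ s))) ≡ 𝟙 s * 𝟙 (p ∧ (not q ∧ r))
𝟙-split true  true  r     s     = sym (*-zeroʳ (𝟙 s))
𝟙-split true  false true  true  = refl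
𝟙-split true  false true  false = refl
𝟙-split true  false false s     = sym (*-zeroʳ (𝟙 s))
𝟙-split false q     r     s     = sym (*-zeroʳ (𝟙 s))

-- Pascal's rule, summed against an arbitrary weight G.
pascal-Σ : ∀ N c (G : ℕ → ℕ) → c ≤ N →
  Σ< (suc N) (λ k → (c C k) * G k) + Σ< (suc N) (λ k → (c C k) * G (suc k))
    ≡ Σ< (suc (suc N)) (λ k → (suc c C k) * G k)
pascal-Σ N c G c≤N = begin
  (1 * G 0 + Σ< N f₂) + Σ< (suc N) f₁
    ≡⟨ cong (λ q → (1 * G 0 + q) + Σ< (suc N) f₁) (sym last-vanishes) ⟩
  (1 * G 0 + Σ< (suc N) f₂) + Σ< (suc N) f₁
    ≡⟨ +-assoc (1 * G 0) (Σ< (suc N) f₂) _ ⟩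
  1 * G 0 + (Σ< (suc N) f₂ + Σ< (suc N) f₁)
    ≡⟨ cong (1 * G 0 +_) (trans (+-comm (Σ< (suc N) f₂) _) (sym (Σ<-+ (suc N) f₁ f₂))) ⟩
  1 * G 0 + Σ< (suc N) (λ k → f₁ k + f₂ k)
    ≡⟨ cong (1 * G 0 +_) (Σ<-cong (suc N) _ _ (λ {k} _ → pascal k)) ⟩
  1 * G 0 + Σ< (suc N) (λ k → (suc c C suc k) * G (suc k)) ∎
  where
  open ≡-Reasoning
  f₁ f₂ : ℕ → ℕ
  f₁ k = (c C k) * G (suc k)
  f₂ k = (c C suc k) * G (suc k)
  last-vanishes : Σ< (suc N) f₂ ≡ Σ< N f₂
  last-vanishes = trans (Σ<-snoc N f₂)
    (trans (cong (λ q → Σ< N f₂ + q * G (suc N)) (k>n⇒nCk≡0 (s≤s c≤N))) (+-identityʳ _))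
  pascal : ∀ k → f₁ k + f₂ k ≡ (suc c C suc k) * G (suc k)
  pascal k = trans (sym (*-distribʳ-+ (G (suc k)) (c C k) (c C suc k)))
                   (cong (_* G (suc k)) (nCk+nC[k+1]≡[n+1]C[k+1] c k))

-- ΣSub L F = Σ { F b k | b ⊆ L, |b| = k }: the sum over all subsets of
-- the list L, each coded as b = Σ_{u ∈ b} 2^u together with its size k.
ΣSub : List ℕ → (ℕ → ℕ → ℕ) → ℕ
ΣSub []      F = F 0 0
ΣSub (u ∷ L) F = ΣSub L F + ΣSub L (λ b k → F (b + 2 ^ u) (suc k))

data SubsetOf : List ℕ → ℕ → ℕ → Set where
  nil  : SubsetOf [] 0 0
  skip : ∀ {u L b k} → SubsetOf L b k → SubsetOf (u ∷ L) b k
  take : ∀ {u L b k} → SubsetOf L b k → SubsetOf (u ∷ L) (b + 2 ^ u) (suc k)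

ΣSub-cong : ∀ L F G → (∀ {b k} → SubsetOf L b k → F b k ≡ G b k) → ΣSub L F ≡ ΣSub L G
ΣSub-cong []      F G eq = eq nil
ΣSub-cong (u ∷ L) F G eq = cong₂ _+_ (ΣSub-cong L F G (eq ∘ skip)) (ΣSub-cong L _ _ (eq ∘ take))

ΣSub-zero : ∀ L F → (∀ {b k} → SubsetOf L b k → F b k ≡ 0) → ΣSub L F ≡ 0
ΣSub-zero []      F F≡0 = F≡0 nil
ΣSub-zero (u ∷ L) F F≡0 = cong₂ _+_ (ΣSub-zero L F (F≡0 ∘ skip)) (ΣSub-zero L _ (F≡0 ∘ take))

ΣSub-+ : ∀ L F G → ΣSub L (λ b k → F b k + G b k) ≡ ΣSub L F + ΣSub L G
ΣSub-+ []      F G = refl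
ΣSub-+ (u ∷ L) F G = trans (cong₂ _+_ (ΣSub-+ L F G) (ΣSub-+ L _ _)) (+-interchange (ΣSub L F) _ _ _)

ΣSub-scale : ∀ L c F → ΣSub L (λ b k → c * F b k) ≡ c * ΣSub L F
ΣSub-scale []      c F = refl
ΣSub-scale (u ∷ L) c F =
  trans (cong₂ _+_ (ΣSub-scale L c F) (ΣSub-scale L c _)) (sym (*-distribˡ-+ c (ΣSub L F) _))

ΣSub-++ : ∀ W V F → ΣSub (W ++ V) F ≡ ΣSub W (λ b k → ΣSub V (λ a j → F (a + b) (j + k)))
ΣSub-++ []      V F = ΣSub-cong V _ _ (λ {a} {j} _ → sym (cong₂ F (+-identityʳ a) (+-identityʳ j)))
ΣSub-++ (u ∷ W) V F = cong₂ _+_ (ΣSub-++ W V F)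
  (trans (ΣSub-++ W V _) (ΣSub-cong W _ _ λ {b} {k} _ → ΣSub-cong V _ _ λ {a} {j} _ →
    cong₂ F (+-assoc a b (2 ^ u)) (sym (+-suc j k))))

subset-elements : ∀ {L b k} → Unique L → SubsetOf L b k → b ⊆ₛ L
subset-elements []          nil      z z∈ = ⊥-elim (∅-has-no-element z z∈)
subset-elements (_ ∷ uniq)  (skip s) z z∈ = there (subset-elements uniq s z z∈)
subset-elements {u ∷ L} (u∉L ∷ uniq) (take {b = b} s) z z∈
  with insert-cases u b z (⊆ₛ-fresh u (subset-elements uniq s) (All¬⇒¬Any u∉L)) z∈
... | inj₁ z∈b = there (subset-elements uniq s z z∈b)
... | inj₂ refl = here refl

subset-fresh : ∀ {L b k} u → Unique L → SubsetOf L b k → u ∉ L → u ∉ₛ b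
subset-fresh u uniq s = ⊆ₛ-fresh u (subset-elements uniq s)

disjoint-union : ∀ {L b k} → Unique L → SubsetOf L b k → ∀ a → (∀ z → z ∈ L → z ∉ₛ a) →
  ∀ z → z ∈ₛ (a + b) ⇔ (z ∈ₛ a ⊎ z ∈ₛ b)
disjoint-union [] nil a _ z = mk⇔
  (λ z∈ → inj₁ (subst (z ∈ₛ_) (+-identityʳ a) z∈))
  (⊎-elim (subst (z ∈ₛ_) (sym (+-identityʳ a))) (⊥-elim ∘ ∅-has-no-element z))
disjoint-union (_ ∷ uniq) (skip s) a a#L z = disjoint-union uniq s a (λ z z∈ → a#L z (there z∈)) z
disjoint-union {u ∷ L} (u∉L ∷ uniq) (take {b = b} s) a a#L z = mk⇔ to from
  where
  union = disjoint-union uniq s a (λ z z∈ → a#L z (there z∈))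
  u∉b : u ∉ₛ b
  u∉b = subset-fresh u uniq s (All¬⇒¬Any u∉L)
  u∉a+b : u ∉ₛ (a + b)
  u∉a+b with bit u (a + b) in u∈?
  ... | false = refl
  ... | true  = ⊥-elim (⊎-elim (λ u∈a → true-and-false u∈a (a#L u (here refl)))
                               (λ u∈b → true-and-false u∈b u∉b) (Equivalence.to (union u) u∈?))
  reassoc : a + (b + 2 ^ u) ≡ a + b + 2 ^ u
  reassoc = sym (+-assoc a b (2 ^ u))
  to : z ∈ₛ (a + (b + 2 ^ u)) → z ∈ₛ a ⊎ z ∈ₛ (b + 2 ^ u)
  to z∈ with insert-cases u (a + b) z u∉a+b (subst (z ∈ₛ_) reassoc z∈)
  ... | inj₂ refl = inj₂ (insert-new u b u∉b)
  ... | inj₁ z∈a+b = ⊎-elim inj₁ (λ z∈b → inj₂ (insert-keeps u b z u∉b z∈b)) (Equivalence.to (union z) z∈a+b)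
  from : z ∈ₛ a ⊎ z ∈ₛ (b + 2 ^ u) → z ∈ₛ (a + (b + 2 ^ u))
  from z∈ = subst (z ∈ₛ_) (sym reassoc) (from′ z∈)
    where
    from′ : z ∈ₛ a ⊎ z ∈ₛ (b + 2 ^ u) → z ∈ₛ (a + b + 2 ^ u)
    from′ (inj₁ z∈a) = insert-keeps u (a + b) z u∉a+b (Equivalence.from (union z) (inj₁ z∈a))
    from′ (inj₂ z∈b') with insert-cases u b z u∉b z∈b'
    ... | inj₂ refl = insert-new u (a + b) u∉a+b
    ... | inj₁ z∈b  = insert-keeps u (a + b) z u∉a+b (Equivalence.from (union z) (inj₂ z∈b))

ConjunctiveOn : List ℕ → (ℕ → Bool) → (ℕ → Bool) → Set
ConjunctiveOn W p P = P 0 ≡ true × (∀ {u b} → u ∈ W → u ∉ₛ b → P (b + 2 ^ u) ≡ (P b ∧ p u))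

ΣSub-binomial : ∀ W p P (G : ℕ → ℕ) → Unique W → ConjunctiveOn W p P →
  ΣSub W (λ b k → 𝟙 (P b) * G k) ≡ Σ< (suc (length W)) (λ k → (count p W C k) * G k)
ΣSub-binomial [] p P G _ (P0 , _) rewrite P0 = sym (+-identityʳ (G 0 + 0))
ΣSub-binomial (u ∷ W) p P G (u∉W ∷ uniq) (P0 , P-insert) with p u in pu
... | true = begin
  ΣSub W (λ b k → 𝟙 (P b) * G k) + ΣSub W (λ b k → 𝟙 (P (b + 2 ^ u)) * G (suc k))
    ≡⟨ cong (ΣSub W (λ b k → 𝟙 (P b) * G k) +_) (ΣSub-cong W _ _ λ s → cong (λ q → 𝟙 q * _) (keep s)) ⟩
  ΣSub W (λ b k → 𝟙 (P b) * G k) + ΣSub W (λ b k → 𝟙 (P b) * G (suc k))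
    ≡⟨ cong₂ _+_ (ΣSub-binomial W p P G uniq conj) (ΣSub-binomial W p P (G ∘ suc) uniq conj) ⟩
  Σ< (suc (length W)) (λ k → (c C k) * G k) + Σ< (suc (length W)) (λ k → (c C k) * G (suc k))
    ≡⟨ pascal-Σ (length W) c G (count≤length p W) ⟩
  Σ< (suc (suc (length W))) (λ k → (suc c C k) * G k) ∎
  where
  open ≡-Reasoning
  c = count p W
  conj : ConjunctiveOn W p P
  conj = P0 , P-insert ∘ there
  keep : ∀ {b k} → SubsetOf W b k → P (b + 2 ^ u) ≡ P b
  keep {b} s = trans (P-insert (here refl) (subset-fresh u uniq s (All¬⇒¬Any u∉W)))
                     (trans (cong (P b ∧_) pu) (∧-identityʳ (P b)))
... | false = begin
  ΣSub W (λ b k → 𝟙 (P b) * G k) + ΣSub W (λ b k → 𝟙 (P (b + 2 ^ u)) * G (suc k))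
    ≡⟨ cong₂ _+_ (ΣSub-binomial W p P G uniq conj) (ΣSub-zero W _ λ s → cong (λ q → 𝟙 q * _) (discard s)) ⟩
  Σ< (suc (length W)) (λ k → (c C k) * G k) + 0
    ≡⟨ cong (Σ< (suc (length W)) (λ k → (c C k) * G k) +_) (sym (cong (_* G (suc (length W))) (k>n⇒nCk≡0 (s≤s (count≤length p W))))) ⟩
  Σ< (suc (length W)) (λ k → (c C k) * G k) + (c C suc (length W)) * G (suc (length W))
    ≡⟨ sym (Σ<-snoc (suc (length W)) (λ k → (c C k) * G k)) ⟩
  Σ< (suc (suc (length W))) (λ k → (c C k) * G k) ∎
  where
  open ≡-Reasoning
  c = count p W
  conj : ConjunctiveOn W p P
  conj = P0 , P-insert ∘ there
  discard : ∀ {b k} → SubsetOf W b k → P (b + 2 ^ u) ≡ false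
  discard {b} s = trans (P-insert (here refl) (subset-fresh u uniq s (All¬⇒¬Any u∉W)))
                     (trans (cong (P b ∧_) pu) (∧-zeroʳ (P b)))

subsets : List ℕ → List ℕ
subsets []      = 0 ∷ []
subsets (u ∷ L) = subsets L ++ map (_+ 2 ^ u) (subsets L)

countSub : List ℕ → (ℕ → Bool) → ℕ
countSub U Q = ΣSub U (λ b _ → 𝟙 (Q b))

count-map : ∀ Q f xs → count Q (map f xs) ≡ count (Q ∘ f) xs
count-map Q f []       = refl
count-map Q f (x ∷ xs) with Q (f x)
... | true  = cong suc (count-map Q f xs)
... | false = count-map Q f xs

count-++ : ∀ Q xs ys → count Q (xs ++ ys) ≡ count Q xs + count Q ys
count-++ Q xs ys = trans (cong length (filter-++ (T? ∘ Q) xs ys)) (length-++ (filterᵇ Q xs))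

countSub≡count : ∀ U Q → countSub U Q ≡ count Q (subsets U)
countSub≡count [] Q with Q 0
... | true  = refl
... | false = refl
countSub≡count (u ∷ L) Q = begin
  countSub L Q + countSub L (Q ∘ (_+ 2 ^ u))
    ≡⟨ cong₂ _+_ (countSub≡count L Q) (countSub≡count L (Q ∘ (_+ 2 ^ u))) ⟩
  count Q (subsets L) + count (Q ∘ (_+ 2 ^ u)) (subsets L)
    ≡⟨ cong (count Q (subsets L) +_) (sym (count-map Q (_+ 2 ^ u) (subsets L))) ⟩
  count Q (subsets L) + count Q (map (_+ 2 ^ u) (subsets L))
    ≡⟨ sym (count-++ Q (subsets L) _) ⟩
  count Q (subsets (u ∷ L)) ∎
  where open ≡-Reasoning

countSub-cong : ∀ U Q Q' → (∀ a → Q a ≡ Q' a) → countSub U Q ≡ countSub U Q'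
countSub-cong U Q Q' eq = ΣSub-cong U _ _ λ {a} _ → cong 𝟙 (eq a)

∈-subsets⁻ : ∀ L → Unique L → ∀ {x} → x ∈ subsets L → x ⊆ₛ L
∈-subsets⁻ []      _ (here refl) z z∈ = ⊥-elim (∅-has-no-element z z∈)
∈-subsets⁻ (u ∷ L) (u∉L ∷ uniq) x∈ z z∈ with ∈-++⁻ (subsets L) x∈
... | inj₁ x∈L = there (∈-subsets⁻ L uniq x∈L z z∈)
... | inj₂ x∈u with ∈-map⁻ (_+ 2 ^ u) x∈u
...   | x' , x'∈ , refl
  with insert-cases u x' z (⊆ₛ-fresh u (∈-subsets⁻ L uniq x'∈) (All¬⇒¬Any u∉L)) z∈
...     | inj₁ z∈x' = there (∈-subsets⁻ L uniq x'∈ z z∈x')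
...     | inj₂ refl = here refl

∈-subsets⁺ : ∀ L x → x ⊆ₛ L → x ∈ subsets L
∈-subsets⁺ []      x x⊆ = here (no-elements⇒0 x no-element)
  where
  no-element : ∀ y → y ∉ₛ x
  no-element y with bit y x in y∈?
  ... | false = refl
  ... | true  with x⊆ y y∈?
  ...   | ()
∈-subsets⁺ (u ∷ L) x x⊆ with bit u x in u∈?
... | false = ∈-++⁺ˡ (∈-subsets⁺ L x x⊆L)
  where
  x⊆L : x ⊆ₛ L
  x⊆L z z∈ with x⊆ z z∈
  ... | there z∈L = z∈L
  ... | here refl = ⊥-elim (true-and-false z∈ u∈?)
... | true with remove u x u∈?
...   | x' , u∉x' , refl = ∈-++⁺ʳ (subsets L) (∈-map⁺ (_+ 2 ^ u) (∈-subsets⁺ L x' x'⊆L))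
  where
  x'⊆L : x' ⊆ₛ L
  x'⊆L z z∈ with x⊆ z (insert-keeps u x' z u∉x' z∈)
  ... | there z∈L = z∈L
  ... | here refl = ⊥-elim (true-and-false z∈ u∉x')

subsets-unique : ∀ L → Unique L → Unique (subsets L)
subsets-unique []      _            = [] ∷ []
subsets-unique (u ∷ L) (u∉L ∷ uniq) =
  Unique.++⁺ (subsets-unique L uniq) (Unique.map⁺ (+-cancelʳ-≡ (2 ^ u) _ _) (subsets-unique L uniq)) disjoint
  where
  fresh : ∀ {x} → x ∈ subsets L → u ∉ₛ x
  fresh x∈ = ⊆ₛ-fresh u (∈-subsets⁻ L uniq x∈) (All¬⇒¬Any u∉L)
  disjoint : ∀ {x} → ¬ (x ∈ subsets L × x ∈ map (_+ 2 ^ u) (subsets L))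
  disjoint (x∈ , x∈u) with ∈-map⁻ (_+ 2 ^ u) x∈u
  ... | x' , x'∈ , refl = true-and-false (insert-new u x' (fresh x'∈)) (fresh x∈)

ℤ-≤ᵇ-pred : ∀ x t → (ℤ.+ x ℤ.≤ᵇ (ℤ.+ t ℤ.- ℤ.+ 1)) ≡ (suc x ≤ᵇ t)
ℤ-≤ᵇ-pred x zero    = refl
ℤ-≤ᵇ-pred x (suc t) = Bool-ext (λ e → ≤ᵇ-true⁺ {suc x} {suc t} (s≤s (≤ᵇ-true⁻ {x} {t} e)))
                                (λ e → ≤ᵇ-true⁺ {x} {t} (≤-pred (≤ᵇ-true⁻ {suc x} {suc t} e)))

A-pred : ∀ N → A (ℤ.+ N ℤ.- ℤ.+ 1) ≡ Aprev N
A-pred zero    = refl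
A-pred (suc N) = refl

newᵇ : ℕ → (ℕ → Bool) → ℕ → Bool
newᵇ N q x = (x ∈ᴸ Aℕ N) ∧ (not (x ∈ᴸ Aprev N) ∧ q x)

r≡countSub : ∀ N (M T : ℤ.ℤ) (q : ℕ → Bool) U → Unique U → (∀ x → (ℤ.+ rk x ℤ.≤ᵇ T) ≡ q x) →
  (∀ {x y} → x ∈ Aℕ N → y ∈ₛ x → y ∈ A M ⇔ y ∈ U) →
  r (ℤ.+ N) M T ≡ countSub U (newᵇ N q)
r≡countSub N M T q U uniq rank-test A-M⇔U = trans
  (same-elements⇒same-length (dedup-unique (filterᵇ inRᴺ (Aℕ N)))
     (Unique.filter⁺ (T? ∘ newᵇ N q) (subsets-unique U uniq)) R⊆ ⊆R)
  (sym (countSub≡count U (newᵇ N q)))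
  where
  inRᴺ = inR (ℤ.+ N) M T
  unfold-inR : ∀ x → inRᴺ x ≡ (not (x ∈ᴸ Aprev N) ∧ (all (_∈ᴸ A M) (members x) ∧ (ℤ.+ rk x ℤ.≤ᵇ T)))
  unfold-inR x = cong (λ L → not (x ∈ᴸ L) ∧ _) (A-pred N)
  R⊆ : ∀ {x} → x ∈ dedup (filterᵇ inRᴺ (Aℕ N)) → x ∈ filterᵇ (newᵇ N q) (subsets U)
  R⊆ {x} x∈ with ∈-filterᵇ⁻ inRᴺ (Aℕ N) (∈-dedup⁻ _ x∈)
  ... | x∈A , in-R with ∧-true⁻ (trans (sym (unfold-inR x)) in-R)
  ...   | new , rest with ∧-true⁻ rest
  ...     | elements , rank =
    ∈-filterᵇ⁺ (newᵇ N q) (∈-subsets⁺ U x x⊆U) (∧-true⁺ (∈⇒∈ᴸ x∈A) (∧-true⁺ new (trans (sym (rank-test x)) rank)))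
    where
    x⊆U : x ⊆ₛ U
    x⊆U y y∈x = Equivalence.to (A-M⇔U x∈A y∈x)
      (∈ᴸ⇒∈ (A M) (all-true⁻ _ (members x) elements (∈-members⁺ {y} x y∈x)))
  ⊆R : ∀ {x} → x ∈ filterᵇ (newᵇ N q) (subsets U) → x ∈ dedup (filterᵇ inRᴺ (Aℕ N))
  ⊆R {x} x∈ with ∈-filterᵇ⁻ (newᵇ N q) (subsets U) x∈
  ... | x∈subsets , test with ∧-true⁻ test
  ...   | in-A , rest with ∧-true⁻ rest
  ...     | new , rank = ∈-dedup⁺ _ (∈-filterᵇ⁺ inRᴺ x∈A (trans (unfold-inR x)
            (∧-true⁺ new (∧-true⁺ (all-true⁺ _ (members x) elements) (trans (rank-test x) rank)))))
    where
    x∈A = ∈ᴸ⇒∈ (Aℕ N) in-A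
    elements : ∀ {y} → y ∈ members x → (y ∈ᴸ A M) ≡ true
    elements {y} y∈ = ∈⇒∈ᴸ (Equivalence.from (A-M⇔U x∈A y∈x) (∈-subsets⁻ U uniq x∈subsets y y∈x))
      where y∈x = ∈-members⁻ x y∈

-- Where a ∪ b lands in the hierarchy when a ⊆ A_{m-1} and b consists of
-- k new elements of level m: for k = 0 this is a ∈ A_N, and for k > 0 it
-- is m + k ≤ N together with a ∈ A_{N-k}.
LevelOK : ℕ → ℕ → ℕ → ℕ → Set
LevelOK m N zero    a = a ∈ Aℕ N
LevelOK m N (suc k) a = m + suc k ≤ N × a ∈ Aℕ (N ∸ suc k)

levelᵇ : ℕ → ℕ → ℕ → ℕ → Bool
levelᵇ m N zero    a = a ∈ᴸ Aℕ N
levelᵇ m N (suc k) a = (m + suc k ≤ᵇ N) ∧ (a ∈ᴸ Aℕ (N ∸ suc k))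

levelᵇ⁻ : ∀ m N k a → levelᵇ m N k a ≡ true → LevelOK m N k a
levelᵇ⁻ m N zero    a e = ∈ᴸ⇒∈ (Aℕ N) e
levelᵇ⁻ m N (suc k) a e = ≤ᵇ-true⁻ (proj₁ (∧-true⁻ e)) , ∈ᴸ⇒∈ (Aℕ (N ∸ suc k)) (proj₂ (∧-true⁻ e))

levelᵇ⁺ : ∀ m N k a → LevelOK m N k a → levelᵇ m N k a ≡ true
levelᵇ⁺ m N zero    a a∈       = ∈⇒∈ᴸ a∈
levelᵇ⁺ m N (suc k) a (le , a∈) = ∧-true⁺ (≤ᵇ-true⁺ le) (∈⇒∈ᴸ a∈)

LevelOK-suc⁺ : ∀ m N' k a → m ≤ N' → LevelOK m N' k a → LevelOK m (suc N') (suc k) a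
LevelOK-suc⁺ m N' zero     a m≤N' a∈        = subst (_≤ suc N') (+-comm 1 m) (s≤s m≤N') , a∈
LevelOK-suc⁺ m N' (suc k') a _    (le , a∈) = subst (_≤ suc N') (sym (+-suc m (suc k'))) (s≤s le) , a∈

LevelOK-suc⁻ : ∀ m N k a → LevelOK m N (suc k) a → ∃ λ N' → N ≡ suc N' × m ≤ N' × LevelOK m N' k a
LevelOK-suc⁻ m zero     k        a (le , _)  = ⊥-elim (n≮0 (subst (_≤ 0) (+-suc m k) le))
LevelOK-suc⁻ m (suc N') zero     a (le , a∈) = N' , refl , ≤-pred (subst (_≤ suc N') (+-comm m 1) le) , a∈
LevelOK-suc⁻ m (suc N') (suc k') a (le , a∈) = N' , refl , ≤-trans (m≤m+n m (suc k')) le' , le' , a∈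
  where
  le' : m + suc k' ≤ N'
  le' = ≤-pred (subst (_≤ suc N') (+-suc m (suc k')) le)

NewList : ℕ → List ℕ → Set
NewList m W = ∀ {u} → u ∈ W → NewAt m u

level-of-union : ∀ m W → Unique W → NewList m W → ∀ {b k} → SubsetOf W b k →
  ∀ a → (∀ z → z ∈ₛ a → z ∈ Aprev m) → ∀ N → (a + b ∈ Aℕ N) ⇔ LevelOK m N k a
level-of-union m [] _ _ nil a _ N =
  mk⇔ (subst (_∈ Aℕ N) (+-identityʳ a)) (subst (_∈ Aℕ N) (sym (+-identityʳ a)))
level-of-union m (u ∷ W) (_ ∷ uniq) new (skip s) a a⊆ N =
  level-of-union m W uniq (new ∘ there) s a a⊆ N
level-of-union m (u ∷ W) (u∉W ∷ uniq) new (take {b = b} {k = k} s) a a⊆ N = mk⇔ to from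
  where
  level = level-of-union m W uniq (new ∘ there) s a a⊆
  a#W : ∀ z → z ∈ W → z ∉ₛ a
  a#W z z∈W = ⊆ₛ-fresh z a⊆ (proj₂ (new (there z∈W)))
  union = disjoint-union uniq s a a#W
  u∉a+b : u ∉ₛ (a + b)
  u∉a+b with bit u (a + b) in u∈?
  ... | false = refl
  ... | true  = ⊥-elim (⊎-elim (λ u∈a → proj₂ (new (here refl)) (a⊆ u u∈a))
                               (λ u∈b → true-and-false u∈b (subset-fresh u uniq s (All¬⇒¬Any u∉W)))
                               (Equivalence.to (union u) u∈?))
  elements-in-Am : ∀ v → v ∈ₛ (a + b + 2 ^ u) → v ∈ Aℕ m
  elements-in-Am v v∈ with insert-cases u (a + b) v u∉a+b v∈
  ... | inj₂ refl = proj₁ (new (here refl))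
  ... | inj₁ v∈a+b = ⊎-elim (λ v∈a → Aprev⊆A m (a⊆ v v∈a))
                            (λ v∈b → proj₁ (new (there (subset-elements uniq s v v∈b))))
                            (Equivalence.to (union v) v∈a+b)
  reassoc : a + (b + 2 ^ u) ≡ a + b + 2 ^ u
  reassoc = sym (+-assoc a b (2 ^ u))
  to : a + (b + 2 ^ u) ∈ Aℕ N → LevelOK m N (suc k) a
  to a+b∈ with insert-top⁻ m N u (a + b) u∉a+b (new (here refl)) elements-in-Am (subst (_∈ Aℕ N) reassoc a+b∈)
  ... | N' , refl , m≤N' , a+b∈N' = LevelOK-suc⁺ m N' k a m≤N' (Equivalence.to (level N') a+b∈N')
  from : LevelOK m N (suc k) a → a + (b + 2 ^ u) ∈ Aℕ N
  from ok with LevelOK-suc⁻ m N k a ok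
  ... | N' , refl , m≤N' , ok' = subst (_∈ Aℕ (suc N')) (sym reassoc)
    (insert-top⁺ N' u (a + b) u∉a+b (A-mono≤ m≤N' (proj₁ (new (here refl)))) (Equivalence.from (level N') ok'))

module Recursion (n' m t : ℕ) (m≤n' : m ≤ n') where

  n : ℕ
  n = suc n'

  V W U : List ℕ
  V = dedup (Aprev m)
  W = filterᵇ (λ u → not (u ∈ᴸ Aprev m)) (dedup (Aℕ m))
  U = W ++ V

  V-unique : Unique V
  V-unique = dedup-unique (Aprev m)

  W-unique : Unique W
  W-unique = Unique.filter⁺ _ (dedup-unique (Aℕ m))

  W-new : NewList m W
  W-new u∈W with ∈-filterᵇ⁻ _ (dedup (Aℕ m)) u∈W
  ... | u∈ , u∉prev = ∈-dedup⁻ (Aℕ m) u∈ , λ u∈prev → true-and-false (∈⇒∈ᴸ u∈prev) (not-true⁻ u∉prev)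

  U-unique : Unique U
  U-unique = Unique.++⁺ W-unique V-unique λ (u∈W , u∈V) → proj₂ (W-new u∈W) (∈-dedup⁻ (Aprev m) u∈V)

  ∈U⇔∈A : ∀ {y} → y ∈ Aℕ m ⇔ y ∈ U
  ∈U⇔∈A {y} = mk⇔ to (⊎-elim (proj₁ ∘ W-new) (Aprev⊆A m ∘ ∈-dedup⁻ (Aprev m)) ∘ ∈-++⁻ W)
    where
    to : y ∈ Aℕ m → y ∈ U
    to y∈ with y ∈ᴸ Aprev m in old?
    ... | true  = ∈-++⁺ʳ W (∈-dedup⁺ (Aprev m) (∈ᴸ⇒∈ (Aprev m) old?))
    ... | false = ∈-++⁺ˡ (∈-filterᵇ⁺ _ (∈-dedup⁺ (Aℕ m) y∈) (not-true⁺ old?))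

  -- V lists A_{m-1}; stated in the form required by r≡countSub.
  ∈V⇔∈A-pred : ∀ N {x y} → x ∈ Aℕ N → y ∈ₛ x → y ∈ A (ℤ.+ m ℤ.- ℤ.+ 1) ⇔ y ∈ V
  ∈V⇔∈A-pred _ {y = y} _ _ = mk⇔ (∈-dedup⁺ (Aprev m) ∘ subst (y ∈_) (A-pred m))
                       (subst (y ∈_) (sym (A-pred m)) ∘ ∈-dedup⁻ (Aprev m))

  rankᵇ : ℕ → Bool
  rankᵇ x = rk x ≤ᵇ t

  r-as-subsets : r (ℤ.+ n) (ℤ.+ m) (ℤ.+ t) ≡ countSub U (newᵇ n rankᵇ)
  r-as-subsets = r≡countSub n (ℤ.+ m) (ℤ.+ t) rankᵇ U U-unique (λ _ → refl) (λ _ _ → ∈U⇔∈A)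

  -- For a ∪ b with a ⊆ A_{m-1} and b ⊆ W of size k: membership in
  -- R^t_{n,m} is decided by the test oldTest k on a and rk b ≤ t.
  oldTest : ℕ → ℕ → Bool
  oldTest k a = levelᵇ m n k a ∧ (not (levelᵇ m n' k a) ∧ rankᵇ a)

  G : ℕ → ℕ
  G k = countSub V (oldTest k)

  old-elements : ∀ {a j} → SubsetOf V a j → ∀ z → z ∈ₛ a → z ∈ Aprev m
  old-elements sa z z∈ = ∈-dedup⁻ (Aprev m) (subset-elements V-unique sa z z∈)

  level-test : ∀ {a j b k} → SubsetOf V a j → SubsetOf W b k → ∀ N → ((a + b) ∈ᴸ Aℕ N) ≡ levelᵇ m N k a
  level-test {a} {k = k} sa sb N = Bool-ext
    (λ e → levelᵇ⁺ m N k a (Equivalence.to (level N) (∈ᴸ⇒∈ (Aℕ N) e)))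
    (λ e → ∈⇒∈ᴸ (Equivalence.from (level N) (levelᵇ⁻ m N k a e)))
    where level = level-of-union m W W-unique W-new sb a (old-elements sa)

  rank-test : ∀ {a j b k} → SubsetOf V a j → SubsetOf W b k → rankᵇ (a + b) ≡ (rankᵇ a ∧ rankᵇ b)
  rank-test {a} {b = b} sa sb = Bool-ext
    (λ e → let (a≤ , b≤) = Equivalence.to rank (≤ᵇ-true⁻ e) in ∧-true⁺ (≤ᵇ-true⁺ a≤) (≤ᵇ-true⁺ b≤))
    (λ e → let (a≤ , b≤) = ∧-true⁻ e in ≤ᵇ-true⁺ (Equivalence.from rank (≤ᵇ-true⁻ a≤ , ≤ᵇ-true⁻ b≤)))
    where
    a#W : ∀ z → z ∈ W → z ∉ₛ a
    a#W z z∈W = ⊆ₛ-fresh z (old-elements sa) (proj₂ (W-new z∈W))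
    rank = rk-union≤ a b (a + b) (disjoint-union W-unique sb a a#W)

  split-new-old : countSub U (newᵇ n rankᵇ) ≡ ΣSub W (λ b k → 𝟙 (rankᵇ b) * G k)
  split-new-old = trans (ΣSub-++ W V _) (ΣSub-cong W _ _ λ {b} {k} sb →
    trans (ΣSub-cong V _ (λ a _ → 𝟙 (rankᵇ b) * 𝟙 (oldTest k a)) λ {a} sa → begin
      𝟙 (newᵇ n rankᵇ (a + b))
        ≡⟨ cong₂ (λ p q → 𝟙 (p ∧ (not q ∧ rankᵇ (a + b)))) (level-test sa sb n) (level-test sa sb n') ⟩
      𝟙 (levelᵇ m n k a ∧ (not (levelᵇ m n' k a) ∧ rankᵇ (a + b)))
        ≡⟨ cong (λ s → 𝟙 (levelᵇ m n k a ∧ (not (levelᵇ m n' k a) ∧ s))) (rank-test sa sb) ⟩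
      𝟙 (levelᵇ m n k a ∧ (not (levelᵇ m n' k a) ∧ (rankᵇ a ∧ rankᵇ b)))
        ≡⟨ 𝟙-split (levelᵇ m n k a) (levelᵇ m n' k a) (rankᵇ a) (rankᵇ b) ⟩
      𝟙 (rankᵇ b) * 𝟙 (oldTest k a) ∎)
    (ΣSub-scale V (𝟙 (rankᵇ b)) (λ a _ → 𝟙 (oldTest k a))))
    where open ≡-Reasoning

  smallRankᵇ : ℕ → Bool
  smallRankᵇ u = suc (rk u) ≤ᵇ t

  rank-conjunctive : ConjunctiveOn W smallRankᵇ rankᵇ
  rank-conjunctive = refl , λ {u} {b} _ u∉b → Bool-ext
    (λ e → let (b≤ , u<) = Equivalence.to (rk-insert≤ u b u∉b) (≤ᵇ-true⁻ e) in ∧-true⁺ (≤ᵇ-true⁺ b≤) (≤ᵇ-true⁺ u<))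
    (λ e → let (b≤ , u<) = ∧-true⁻ e in ≤ᵇ-true⁺ (Equivalence.from (rk-insert≤ u b u∉b) (≤ᵇ-true⁻ b≤ , ≤ᵇ-true⁻ u<)))

  by-size : ΣSub W (λ b k → 𝟙 (rankᵇ b) * G k) ≡ Σ< (suc (length W)) (λ k → (count smallRankᵇ W C k) * G k)
  by-size = ΣSub-binomial W smallRankᵇ rankᵇ G W-unique rank-conjunctive

  count-small-new : count smallRankᵇ W ≡ r (ℤ.+ m) (ℤ.+ m ℤ.- ℤ.+ 1) (ℤ.+ t ℤ.- ℤ.+ 1)
  count-small-new = same-elements⇒same-length (Unique.filter⁺ _ W-unique) (dedup-unique _) ⊆R R⊆
    where
    inRᵐ = inR (ℤ.+ m) (ℤ.+ m ℤ.- ℤ.+ 1) (ℤ.+ t ℤ.- ℤ.+ 1)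
    unfold-inR : ∀ x → inRᵐ x ≡ (not (x ∈ᴸ Aprev m) ∧ (all (_∈ᴸ A (ℤ.+ m ℤ.- ℤ.+ 1)) (members x) ∧ smallRankᵇ x))
    unfold-inR x = cong₂ (λ L s → not (x ∈ᴸ L) ∧ (all (_∈ᴸ A (ℤ.+ m ℤ.- ℤ.+ 1)) (members x) ∧ s))
                         (A-pred m) (ℤ-≤ᵇ-pred (rk x) t)
    ⊆R : ∀ {x} → x ∈ filterᵇ smallRankᵇ W → x ∈ dedup (filterᵇ inRᵐ (Aℕ m))
    ⊆R {x} x∈ with ∈-filterᵇ⁻ smallRankᵇ W x∈
    ... | x∈W , small with W-new x∈W
    ...   | x∈A , x∉prev = ∈-dedup⁺ _ (∈-filterᵇ⁺ inRᵐ x∈A (trans (unfold-inR x)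
            (∧-true⁺ (not-true⁺ (∉⇒∉ᴸ (Aprev m) x∉prev)) (∧-true⁺ (all-true⁺ _ (members x) elements) small))))
      where
      elements : ∀ {y} → y ∈ members x → (y ∈ᴸ A (ℤ.+ m ℤ.- ℤ.+ 1)) ≡ true
      elements {y} y∈ = ∈⇒∈ᴸ (subst (y ∈_) (sym (A-pred m)) (A-elements-prev m x∈A (∈-members⁻ x y∈)))
    R⊆ : ∀ {x} → x ∈ dedup (filterᵇ inRᵐ (Aℕ m)) → x ∈ filterᵇ smallRankᵇ W
    R⊆ {x} x∈ with ∈-filterᵇ⁻ inRᵐ (Aℕ m) (∈-dedup⁻ _ x∈)
    ... | x∈A , in-R with ∧-true⁻ (trans (sym (unfold-inR x)) in-R)
    ...   | new , rest = ∈-filterᵇ⁺ smallRankᵇ (∈-filterᵇ⁺ _ (∈-dedup⁺ (Aℕ m) x∈A) new) (proj₂ (∧-true⁻ rest))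

  -- The values of G: the old part a of a member of R^t_{n,m} with k new
  -- elements is itself a member of R^t_{n-k,m-1}, as long as m + k < n …
  G-zero : G 0 ≡ r (ℤ.+ n) (ℤ.+ m ℤ.- ℤ.+ 1) (ℤ.+ t)
  G-zero = sym (r≡countSub n (ℤ.+ m ℤ.- ℤ.+ 1) (ℤ.+ t) rankᵇ V V-unique (λ _ → refl) (∈V⇔∈A-pred n))

  G-middle : ∀ k → m + suc k ≤ n' → G (suc k) ≡ r (ℤ.+ (n ∸ suc k)) (ℤ.+ m ℤ.- ℤ.+ 1) (ℤ.+ t)
  G-middle k m+k<n = trans (countSub-cong V _ _ same-test)
    (sym (r≡countSub (n' ∸ k) (ℤ.+ m ℤ.- ℤ.+ 1) (ℤ.+ t) rankᵇ V V-unique (λ _ → refl) (∈V⇔∈A-pred (n' ∸ k))))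
    where
    same-test : ∀ a → oldTest (suc k) a ≡ newᵇ (n' ∸ k) rankᵇ a
    same-test a rewrite ≤ᵇ-true⁺ (m≤n⇒m≤1+n m+k<n) | ≤ᵇ-true⁺ m+k<n
                      | +-∸-assoc 1 (≤-trans (m≤n+m (suc k) m) m+k<n) = refl

  -- … there are none once m + k > n …
  G-beyond : ∀ k → ¬ m + suc k ≤ n → G (suc k) ≡ 0
  G-beyond k m+k≰n = ΣSub-zero V _ λ {a} _ → cong 𝟙 (no-test a)
    where
    no-test : ∀ a → oldTest (suc k) a ≡ false
    no-test a rewrite ≤ᵇ-false m+k≰n = refl

  -- … and for m + k = n the old part is any a ∈ A_m of rank ≤ t, counted
  -- level by level.
  r-diag : ℕ → ℕ
  r-diag i = r (ℤ.+ i) (ℤ.+ i ℤ.- ℤ.+ 1) (ℤ.+ t)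

  r-level : ∀ i → i ≤ m → countSub V (newᵇ i rankᵇ) ≡ r-diag i
  r-level i i≤m = sym (r≡countSub i (ℤ.+ i ℤ.- ℤ.+ 1) (ℤ.+ t) rankᵇ V V-unique (λ _ → refl) λ {x} {y} x∈ y∈x → mk⇔
    (λ _ → ∈-dedup⁺ (Aprev m) (Aprev-mono i≤m (A-elements-prev i x∈ y∈x)))
    (λ _ → subst (y ∈_) (sym (A-pred i)) (A-elements-prev i x∈ y∈x)))

  telescope : ∀ j → j ≤ m → countSub V (λ a → (a ∈ᴸ Aℕ j) ∧ rankᵇ a) ≡ Σ< (suc j) r-diag
  telescope zero    _   = trans (r-level 0 z≤n) (sym (+-identityʳ _))
  telescope (suc j) j<m = begin
    countSub V (λ a → (a ∈ᴸ Aℕ (suc j)) ∧ rankᵇ a)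
      ≡⟨ ΣSub-cong V _ _ (λ {a} _ → 𝟙-∧-split (rankᵇ a) (∈⇒∈ᴸ ∘ A-mono j ∘ ∈ᴸ⇒∈ (Aℕ j))) ⟩
    ΣSub V (λ a _ → 𝟙 ((a ∈ᴸ Aℕ j) ∧ rankᵇ a) + 𝟙 (newᵇ (suc j) rankᵇ a))
      ≡⟨ ΣSub-+ V _ _ ⟩
    countSub V (λ a → (a ∈ᴸ Aℕ j) ∧ rankᵇ a) + countSub V (newᵇ (suc j) rankᵇ)
      ≡⟨ cong₂ _+_ (telescope j (≤-trans (n≤1+n j) j<m)) (r-level (suc j) j<m) ⟩
    Σ< (suc j) r-diag + r-diag (suc j)
      ≡⟨ sym (Σ<-snoc (suc j) r-diag) ⟩
    Σ< (suc (suc j)) r-diag ∎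
    where open ≡-Reasoning

  -- n - m = d + 1 is the largest number of new elements that fits.
  d : ℕ
  d = n' ∸ m

  n∸m≡1+d : n ∸ m ≡ suc d
  n∸m≡1+d = +-∸-assoc 1 m≤n'

  m+1+d≡n : m + suc d ≡ n
  m+1+d≡n = trans (+-suc m d) (cong suc (m+[n∸m]≡n m≤n'))

  G-top : G (suc d) ≡ Σ< (suc m) r-diag
  G-top = trans (countSub-cong V _ _ top-test) (telescope m ≤-refl)
    where
    top-test : ∀ a → oldTest (suc d) a ≡ ((a ∈ᴸ Aℕ m) ∧ rankᵇ a)
    top-test a rewrite m+1+d≡n | ≤ᵇ-true⁺ (≤-refl {n}) | ≤ᵇ-false (1+n≰n {n'}) | m∸[m∸n]≡n m≤n'
      with a ∈ᴸ Aℕ m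
    ... | true  = refl
    ... | false = refl

  c : ℕ
  c = r (ℤ.+ m) (ℤ.+ m ℤ.- ℤ.+ 1) (ℤ.+ t ℤ.- ℤ.+ 1)

  term : ℕ → ℕ
  term k = (c C k) * G k

  counted-by-size : r (ℤ.+ n) (ℤ.+ m) (ℤ.+ t) ≡ Σ< (suc (length W)) term
  counted-by-size = begin
    r (ℤ.+ n) (ℤ.+ m) (ℤ.+ t)                        ≡⟨ r-as-subsets ⟩
    countSub U (newᵇ n rankᵇ)                        ≡⟨ split-new-old ⟩
    ΣSub W (λ b k → 𝟙 (rankᵇ b) * G k)               ≡⟨ by-size ⟩
    Σ< (suc (length W)) (λ k → (count smallRankᵇ W C k) * G k)
      ≡⟨ cong (λ c′ → Σ< (suc (length W)) (λ k → (c′ C k) * G k)) count-small-new ⟩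
    Σ< (suc (length W)) term                          ∎
    where open ≡-Reasoning

  sizes-up-to : Σ< (suc (length W)) term ≡ Σ< (suc (suc d)) term
  sizes-up-to = begin
    Σ< (suc (length W)) term                     ≡⟨ sym (Σ<-vanishing (suc (length W)) (suc (suc d)) term beyond-c) ⟩
    Σ< (suc (length W) + suc (suc d)) term       ≡⟨ cong (λ N → Σ< N term) (+-comm (suc (length W)) (suc (suc d))) ⟩
    Σ< (suc (suc d) + suc (length W)) term       ≡⟨ Σ<-vanishing (suc (suc d)) (suc (length W)) term beyond-n ⟩
    Σ< (suc (suc d)) term                        ∎
    where
    open ≡-Reasoning
    c≤length : c ≤ length W
    c≤length = subst (_≤ length W) count-small-new (count≤length smallRankᵇ W)
    beyond-c : ∀ {k} → suc (length W) ≤ k → term k ≡ 0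
    beyond-c {k} le = cong (_* G k) (k>n⇒nCk≡0 (≤-trans (s≤s c≤length) le))
    beyond-n : ∀ {k} → suc (suc d) ≤ k → term k ≡ 0
    beyond-n {suc k} (s≤s le) = trans (cong ((c C suc k) *_) (G-beyond k m+k≰n)) (*-zeroʳ (c C suc k))
      where
      n<m+k : n < m + suc k
      n<m+k = subst (_≤ m + suc k) (trans (+-suc m (suc d)) (cong suc m+1+d≡n)) (+-monoʳ-≤ m (s≤s le))
      m+k≰n : ¬ m + suc k ≤ n
      m+k≰n = <⇒≱ n<m+k

  first-size : term 0 ≡ r (ℤ.+ n) (ℤ.+ m ℤ.- ℤ.+ 1) (ℤ.+ t)
  first-size = trans (*-identityˡ (G 0)) G-zero

  middle : ℕ → ℕ
  middle k = r (ℤ.+ (n ∸ k)) (ℤ.+ m ℤ.- ℤ.+ 1) (ℤ.+ t) * (c C k)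

  middle-sizes : Σ< d (term ∘ suc) ≡ sumFromTo 1 (n ∸ m ∸ 1) middle
  middle-sizes = begin
    Σ< d (term ∘ suc)                       ≡⟨ Σ<-cong d _ _ (λ i<d → term≡middle (bound i<d)) ⟩
    Σ< d (middle ∘ suc)                     ≡⟨ cong (λ D → Σ< (D ∸ 1) (middle ∘ suc)) (sym n∸m≡1+d) ⟩
    Σ< (n ∸ m ∸ 1) (middle ∘ suc)           ≡⟨ sym (sumFromTo≡Σ< 1 (n ∸ m ∸ 1) middle) ⟩
    sumFromTo 1 (n ∸ m ∸ 1) middle          ∎
    where
    open ≡-Reasoning
    bound : ∀ {i} → i < d → m + suc i ≤ n'
    bound i<d = subst (m + suc _ ≤_) (m+[n∸m]≡n m≤n') (+-monoʳ-≤ m i<d)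
    term≡middle : ∀ {i} → m + suc i ≤ n' → term (suc i) ≡ middle (suc i)
    term≡middle {i} le = trans (cong ((c C suc i) *_) (G-middle i le)) (*-comm (c C suc i) _)

  top-size : term (suc d) ≡ (c C (n ∸ m)) * sumFromTo 0 m r-diag
  top-size = cong₂ _*_ (cong (c C_) (sym n∸m≡1+d)) (trans G-top (sym (sumFromTo≡Σ< 0 m r-diag)))

open import Data.Integer using (+_; _-_)

theorem3 : (n m t : ℕ) → m < n → t ≤ suc m →
    r (+ n) (+ m) (+ t)
      ≡ r (+ n) (+ m - + 1) (+ t)
        + sumFromTo 1 (n ∸ m ∸ 1)
            (λ k → r (+ (n ∸ k)) (+ m - + 1) (+ t) * (r (+ m) (+ m - + 1) (+ t - + 1) C k))
        + (r (+ m) (+ m - + 1) (+ t - + 1) C (n ∸ m))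
          * sumFromTo 0 m (λ k → r (+ k) (+ k - + 1) (+ t))
theorem3 (suc n') m t (s≤s m≤n') _ = begin
  r (+ suc n') (+ m) (+ t)                  ≡⟨ counted-by-size ⟩
  Σ< (suc (length W)) term                  ≡⟨ sizes-up-to ⟩
  Σ< (suc (suc d)) term                     ≡⟨ Σ<-first-last d term ⟩
  term 0 + Σ< d (term ∘ suc) + term (suc d)
    ≡⟨ cong₂ _+_ (cong₂ _+_ first-size middle-sizes) top-size ⟩
  r (+ suc n') (+ m - + 1) (+ t) + sumFromTo 1 (suc n' ∸ m ∸ 1) middle + (c C (suc n' ∸ m)) * sumFromTo 0 m r-diag ∎
  where
  open ≡-Reasoning
  open Recursion n' m t m≤n'
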